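{- Suppose that $k\ge 2$ and $H$ is a graph with at most $2k$ vertices. Then $H$ is $\mathcal{F}_k$-free if and only if every cycle in $H$ is odd and every connected component of $H$ contains at most one odd cycle.
   Context: Graphs are finite and simple. For $k\ge 2$, $\mathcal{F}_k$ is the family of graphs on at most $2k$ vertices consisting of (a) even cycles, and (b) graphs obtained by joining two odd cycles by a path (the path may have length $0$, i.e. the two odd cycles share exactly one vertex). A graph is $\mathcal{F}_k$-free if it contains no subgraph isomorphic to a member of $\mathcal{F}_k$. -}

module Defs where

open import Data.Nat using (ℕ; zero; suc; _+_; _∸_; _≤_)
open import Data.Nat.Divisibility using (_∣_)
open import Data.Fin using (Fin; zero; suc; inject₁; fromℕ; toℕ)
open import Data.Product using (Σ; _×_; ∃; ∃-syntax)
open import Data.Empty using (⊥)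
open import Data.Sum using (_⊎_)
open import Relation.Nullary using (¬_; Dec)
open import Relation.Binary.PropositionalEquality using (_≡_)
open import Function.Definitions using (Injective)
open import Function.Bundles using (_⇔_)

record Graph (n : ℕ) : Set₁ where
  field
    Adj    : Fin n → Fin n → Set
    sym    : ∀ {u v} → Adj u v → Adj v u
    irrefl : ∀ {u} → ¬ Adj u u
    dec    : ∀ u v → Dec (Adj u v)
open Graph public

Even Odd : ℕ → Set
Even m = 2 ∣ m
Odd m = ¬ (2 ∣ m)

module _ {n : ℕ} (H : Graph n) where

  -- A cycle of length (suc m) in H (a subgraph isomorphic to C_{suc m}):
  -- distinct vertices c 0, …, c m, consecutive ones adjacent, and c m adjacent to c 0.
  record Cycle (m : ℕ) : Set where
    field
      len≥3   : 2 ≤ m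
      vtx     : Fin (suc m) → Fin n
      inj     : Injective _≡_ _≡_ vtx
      step    : ∀ (i : Fin m) → Adj H (vtx (inject₁ i)) (vtx (suc i))
      closing : Adj H (vtx (fromℕ m)) (vtx zero)
  open Cycle public

  CycleEdge : ∀ {m} → Cycle m → Fin n → Fin n → Set
  CycleEdge {m} C u v =
      (∃[ i ] ((vtx C (inject₁ i) ≡ u × vtx C (suc i) ≡ v)
             ⊎ (vtx C (inject₁ i) ≡ v × vtx C (suc i) ≡ u)))
    ⊎ ((vtx C (fromℕ m) ≡ u × vtx C zero ≡ v)
     ⊎ (vtx C (fromℕ m) ≡ v × vtx C zero ≡ u))

  -- Two cycles are the same subgraph of H iff they have the same edge set.
  SameCycle : ∀ {m m'} → Cycle m → Cycle m' → Set
  SameCycle C C' = ∀ u v → CycleEdge C u v ⇔ CycleEdge C' u v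

  record Path (p : ℕ) : Set where
    field
      pvtx  : Fin (suc p) → Fin n
      pinj  : Injective _≡_ _≡_ pvtx
      pstep : ∀ (i : Fin p) → Adj H (pvtx (inject₁ i)) (pvtx (suc i))
  open Path public

  record Walk (u v : Fin n) : Set where
    field
      wlen  : ℕ
      wvtx  : Fin (suc wlen) → Fin n
      wstart : wvtx zero ≡ u
      wend   : wvtx (fromℕ wlen) ≡ v
      wstep : ∀ (i : Fin wlen) → Adj H (wvtx (inject₁ i)) (wvtx (suc i))

  Connected : Fin n → Fin n → Set
  Connected u v = Walk u v

  -- A subgraph of H consisting of two cycles (lengths suc m₁, suc m₂) joined by a
  -- path of length p (p = 0: the cycles share exactly one vertex), all otherwise disjoint.
  record TwoCyclesPath (m₁ m₂ p : ℕ) : Set where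
    field
      C₁ : Cycle m₁
      C₂ : Cycle m₂
      P  : Path p
      start : pvtx P zero ≡ vtx C₁ zero
      end   : pvtx P (fromℕ p) ≡ vtx C₂ zero
      disj₁₂ : ∀ i j → vtx C₁ i ≡ vtx C₂ j → (p ≡ 0 × i ≡ zero × j ≡ zero)
      disjP₁ : ∀ i j → pvtx P i ≡ vtx C₁ j → i ≡ zero
      disjP₂ : ∀ i j → pvtx P i ≡ vtx C₂ j → toℕ i ≡ p

  ContainsFk : ℕ → Set
  ContainsFk k =
      (∃[ m ] (Even (suc m) × suc m ≤ 2 * k × Cycle m))
    ⊎ (∃[ m₁ ] ∃[ m₂ ] ∃[ p ]
         (Odd (suc m₁) × Odd (suc m₂) × (suc m₁ + suc m₂ + p) ∸ 1 ≤ 2 * k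
          × TwoCyclesPath m₁ m₂ p))
    where open import Data.Nat using (_*_)

  FkFree : ℕ → Set
  FkFree k = ¬ ContainsFk k

  AllCyclesOdd : Set
  AllCyclesOdd = ∀ {m} (C : Cycle m) → Odd (suc m)

  AtMostOneOddCyclePerComponent : Set
  AtMostOneOddCyclePerComponent =
    ∀ {m m'} (C : Cycle m) (C' : Cycle m') → Odd (suc m) → Odd (suc m') →
      Connected (vtx C zero) (vtx C' zero) → SameCycle C C'

-- (⇐) An even cycle is excluded outright. The two cycles of a member of 𝓕_k lie in one component
-- (joined by its path) but share at most one vertex, so they are two different odd cycles.
-- (⇒) Since n ≤ 2k, every even cycle and every odd dumbbell (two odd cycles sharing exactly one
-- vertex, or disjoint and joined by a path) of H is a member of 𝓕_k, so H has neither. Then odd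
-- cycles C, C′ joined by a walk share every edge ab of C: otherwise C and C′ are disjoint (a
-- crossing of the walk, with its loops erased, yields a dumbbell), meet in a single vertex
-- (a dumbbell), or C leaves C′ and returns through ab, giving an ear of C′ that is not an edge of
-- C′. The last is impossible: an ear of an odd cycle closes up with the two arcs of the cycle into
-- two cycles of odd total length, one of which is even.
module Submission where

open import Defs hiding (sym)
open import Data.Nat using (ℕ; zero; suc; _+_; _*_; _∸_; _≤_; s≤s; z≤n)
import Data.Nat.Properties as ℕ
open import Data.Nat.Divisibility using (_∣?_; divides; ∣m+n∣m⇒∣n; ∣m∣n⇒∣m+n; m∣m*n; n∣n)
open import Data.Nat.Tactic.RingSolver using (solve-∀)
open import Data.Fin as Fin using (Fin; inject₁; fromℕ; toℕ)
import Data.Fin.Properties as Fin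
open import Data.List using (List; []; _∷_; _++_; _∷ʳ_; length; tabulate; lookup; reverse)
open import Data.List.Properties
  using ( ++-assoc; ++-identityʳ; ++-conicalˡ; ++-conicalʳ; ++-monoid; ∷-injective; ∷ʳ-injective
        ; length-++; length-tabulate; length-reverse; unfold-reverse; reverse-++; reverse-injective )
open import Data.List.Relation.Unary.Any using (Any; here; there) renaming (map to Any-map)
import Data.List.Relation.Unary.Any.Properties as Any
import Data.List.Relation.Unary.All.Properties as All
open import Data.List.Relation.Unary.All.Properties.Core using (¬Any⇒All¬; All¬⇒¬Any)
open import Data.List.Relation.Unary.Linked using (Linked; []; [-]; _∷_; tail)
open import Data.List.Relation.Unary.Unique.Propositional using (Unique; []; _∷_)
open import Data.List.Relation.Unary.Unique.Propositional.Properties using (Unique[x∷xs]⇒x∉xs)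
import Data.List.Relation.Unary.Unique.Propositional.Properties as Unique
open import Data.List.Relation.Binary.Disjoint.Propositional using (Disjoint)
import Data.List.Relation.Binary.Disjoint.Propositional.Properties as Disjoint
open import Data.List.Relation.Binary.Subset.Propositional using (_⊆_)
open import Data.List.Relation.Binary.Subset.Propositional.Properties using (∷⁺ʳ)
open import Data.List.Membership.Propositional using (_∈_; _∉_; find; lose)
open import Data.List.Membership.Propositional.Properties
  using (∈-++⁺ˡ; ∈-++⁺ʳ; ∈-++⁻; ∈-∃++; ∈-lookup; ∈-tabulate⁺)
open import Data.Product using (Σ-syntax; _×_; _,_; ∃-syntax; proj₂)
open import Data.Sum using (_⊎_; inj₁; inj₂; [_,_]′; swap)
open import Data.Empty using (⊥; ⊥-elim)
open import Relation.Nullary using (¬_; Dec; yes; no)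
open import Relation.Nullary.Decidable using (_⊎-dec_)
open import Relation.Binary.Definitions using (DecidableEquality)
open import Relation.Binary.PropositionalEquality
  using (_≡_; _≢_; refl; sym; trans; cong; cong₂; subst; module ≡-Reasoning)
open import Function.Base using (_∘_; id)
open import Function.Bundles using (_⇔_; mk⇔; Equivalence)
import Algebra.Solver.Monoid as MonoidSolver

open Walk using (wlen; wvtx; wstart; wend; wstep)
open TwoCyclesPath using (C₁; C₂; P; start; end; disj₁₂)

module _ {A : Set} where

  disjoint-++ : ∀ {xs ys zs : List A} → Disjoint xs zs → Disjoint ys zs → Disjoint (xs ++ ys) zs
  disjoint-++ {xs} xs#zs ys#zs (v∈ , v∈zs) =
    [ (λ v∈xs → xs#zs (v∈xs , v∈zs)) , (λ v∈ys → ys#zs (v∈ys , v∈zs)) ]′ (∈-++⁻ xs v∈)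

  unique-∷ : ∀ {x : A} {xs} → x ∉ xs → Unique xs → Unique (x ∷ xs)
  unique-∷ {xs = xs} x∉xs u = ¬Any⇒All¬ xs x∉xs ∷ u

  unique-pair : ∀ {x y : A} → x ≢ y → Unique (x ∷ y ∷ [])
  unique-pair x≢y = unique-∷ (λ { (here x≡y) → x≢y x≡y }) (unique-∷ (λ ()) [])

  unique-++⁻ˡ : ∀ (xs : List A) {ys} → Unique (xs ++ ys) → Unique xs
  unique-++⁻ˡ []       _        = []
  unique-++⁻ˡ (x ∷ xs) (x∉ ∷ u) = All.++⁻ˡ xs x∉ ∷ unique-++⁻ˡ xs u

  unique-++⁻ʳ : ∀ (xs : List A) {ys} → Unique (xs ++ ys) → Unique ys
  unique-++⁻ʳ []       u       = u
  unique-++⁻ʳ (x ∷ xs) (_ ∷ u) = unique-++⁻ʳ xs u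

  unique-++⁻-disjoint : ∀ (xs : List A) {ys} → Unique (xs ++ ys) → Disjoint xs ys
  unique-++⁻-disjoint (x ∷ xs) (x∉ ∷ _) (here refl  , v∈ys) = All¬⇒¬Any (All.++⁻ʳ xs x∉) v∈ys
  unique-++⁻-disjoint (x ∷ xs) (_ ∷ u)  (there v∈xs , v∈ys) = unique-++⁻-disjoint xs u (v∈xs , v∈ys)

  unique-reverse : ∀ {xs : List A} → Unique xs → Unique (reverse xs)
  unique-reverse {[]}     []       = []
  unique-reverse {x ∷ xs} (x∉ ∷ u) rewrite unfold-reverse x xs =
    Unique.++⁺ (unique-reverse u) (unique-∷ (λ ()) [])
      (λ { (v∈ , here refl) → All¬⇒¬Any x∉ (Any.reverse⁻ v∈) })

  unique-lookup-injective : ∀ {xs : List A} → Unique xs → ∀ {i j} → lookup xs i ≡ lookup xs j → i ≡ j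
  unique-lookup-injective {x ∷ xs} _        {Fin.zero}  {Fin.zero}  _ = refl
  unique-lookup-injective {x ∷ xs} (x∉ ∷ _) {Fin.zero}  {Fin.suc j} e =
    ⊥-elim (All¬⇒¬Any x∉ (subst (_∈ xs) (sym e) (∈-lookup j)))
  unique-lookup-injective {x ∷ xs} (x∉ ∷ _) {Fin.suc i} {Fin.zero}  e =
    ⊥-elim (All¬⇒¬Any x∉ (subst (_∈ xs) e (∈-lookup i)))
  unique-lookup-injective {x ∷ xs} (_ ∷ u)  {Fin.suc i} {Fin.suc j} e = cong Fin.suc (unique-lookup-injective u e)

  lookup-last : ∀ (h : A) t {z} → lookup (h ∷ t ∷ʳ z) (fromℕ (length (t ∷ʳ z))) ≡ z
  lookup-last h []      = refl
  lookup-last h (y ∷ t) = lookup-last y t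

  data Rotation : List A → List A → Set where
    rotation : ∀ P Q → Rotation (P ++ Q) (Q ++ P)

  rotation′ : ∀ {xs ys} P Q → xs ≡ P ++ Q → ys ≡ Q ++ P → Rotation xs ys
  rotation′ P Q refl refl = rotation P Q

  rotation-sym : ∀ {xs ys} → Rotation xs ys → Rotation ys xs
  rotation-sym (rotation P Q) = rotation Q P

  rotation-⊆ : ∀ {xs ys} → Rotation xs ys → xs ⊆ ys
  rotation-⊆ (rotation P Q) v∈ = [ ∈-++⁺ʳ Q , ∈-++⁺ˡ ]′ (∈-++⁻ P v∈)

  rotation-⊇ : ∀ {xs ys} → Rotation xs ys → ys ⊆ xs
  rotation-⊇ = rotation-⊆ ∘ rotation-sym

  rotation-length : ∀ {xs ys} → Rotation xs ys → length ys ≡ length xs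
  rotation-length (rotation P Q) =
    trans (length-++ Q) (trans (ℕ.+-comm (length Q) (length P)) (sym (length-++ P)))

  to-front : ∀ {x : A} {xs} → x ∈ xs → Σ[ t ∈ List A ] Rotation xs (x ∷ t)
  to-front x∈xs with ∈-∃++ x∈xs
  ... | P , Q , xs≡ = Q ++ P , rotation′ P (_ ∷ Q) xs≡ refl

  two-positions : ∀ {x y : A} {xs} → x ∈ xs → y ∈ xs → x ≢ y →
    (Σ[ P ∈ List A ] Σ[ M ∈ List A ] Σ[ N ∈ List A ] (xs ≡ P ++ x ∷ M ++ y ∷ N)) ⊎
    (Σ[ P ∈ List A ] Σ[ M ∈ List A ] Σ[ N ∈ List A ] (xs ≡ P ++ y ∷ M ++ x ∷ N))
  two-positions (here refl)  (here refl)  x≢y = ⊥-elim (x≢y refl)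
  two-positions (here refl)  (there y∈xs) _ with ∈-∃++ y∈xs
  ... | M , N , refl = inj₁ ([] , M , N , refl)
  two-positions (there x∈xs) (here refl)  _ with ∈-∃++ x∈xs
  ... | M , N , refl = inj₂ ([] , M , N , refl)
  two-positions {xs = z ∷ xs} (there x∈xs) (there y∈xs) x≢y with two-positions x∈xs y∈xs x≢y
  ... | inj₁ (P , M , N , refl) = inj₁ (z ∷ P , M , N , refl)
  ... | inj₂ (P , M , N , refl) = inj₂ (z ∷ P , M , N , refl)

  first-and-last : ∀ {a b : A} {T} P y Q x S → b ∷ T ∷ʳ a ≡ P ++ y ∷ Q ++ x ∷ S → S ++ P ≡ [] →
                   a ≡ x × b ≡ y
  first-and-last []      y Q x []      eq _ =
    let b≡y , T∷ʳa≡ = ∷-injective eq in proj₂ (∷ʳ-injective _ Q T∷ʳa≡) , b≡y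
  first-and-last (_ ∷ _) y Q x []      _  ()
  first-and-last _       y Q x (_ ∷ _) _  ()

  ∈-path : ∀ {v s : A} I {z} → v ∈ s ∷ I ∷ʳ z → v ≡ s ⊎ v ∈ I ⊎ v ≡ z
  ∈-path I (here v≡s) = inj₁ v≡s
  ∈-path I (there v∈) = inj₂ ([ inj₁ , (λ { (here v≡z) → inj₂ v≡z }) ]′ (∈-++⁻ I v∈))

module _ {A : Set} {R : A → A → Set} where

  linked-join : ∀ xs {y ys} → Linked R (xs ∷ʳ y) → Linked R (y ∷ ys) → Linked R (xs ++ y ∷ ys)
  linked-join []               _             l = l
  linked-join (x ∷ [])         (r ∷ [-])     l = r ∷ l
  linked-join (x ∷ x′ ∷ xs)    (r ∷ l₁)      l = r ∷ linked-join (x′ ∷ xs) l₁ l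

  linked-prefix : ∀ xs {y ys} → Linked R (xs ++ y ∷ ys) → Linked R (xs ∷ʳ y)
  linked-prefix []            _       = [-]
  linked-prefix (x ∷ [])      (r ∷ _) = r ∷ [-]
  linked-prefix (x ∷ x′ ∷ xs) (r ∷ l) = r ∷ linked-prefix (x′ ∷ xs) l

  linked-suffix : ∀ xs {y ys} → Linked R (xs ++ y ∷ ys) → Linked R (y ∷ ys)
  linked-suffix []            l       = l
  linked-suffix (x ∷ [])      (_ ∷ l) = l
  linked-suffix (x ∷ x′ ∷ xs) (_ ∷ l) = linked-suffix (x′ ∷ xs) l

  linked-init : ∀ xs {y} → Linked R (xs ∷ʳ y) → Linked R xs
  linked-init []            _       = []
  linked-init (x ∷ [])      _       = [-]
  linked-init (x ∷ x′ ∷ xs) (r ∷ l) = r ∷ linked-init (x′ ∷ xs) l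

  linked-reverse : (∀ {x y} → R x y → R y x) → ∀ {xs} → Linked R xs → Linked R (reverse xs)
  linked-reverse R-sym []      = []
  linked-reverse R-sym [-]     = [-]
  linked-reverse R-sym {x ∷ y ∷ xs} (r ∷ l) =
    subst (Linked R) (sym unfold) (linked-join (reverse xs) reversed-tail (R-sym r ∷ [-]))
    where
    reversed-tail : Linked R (reverse xs ∷ʳ y)
    reversed-tail = subst (Linked R) (unfold-reverse y xs) (linked-reverse R-sym l)
    unfold : reverse (x ∷ y ∷ xs) ≡ reverse xs ++ y ∷ x ∷ []
    unfold = trans (unfold-reverse x (y ∷ xs))
                   (trans (cong (_∷ʳ x) (unfold-reverse y xs)) (++-assoc (reverse xs) (y ∷ []) (x ∷ [])))

  linked-tabulate : ∀ {m} (f : Fin (suc m) → A) → (∀ i → R (f (inject₁ i)) (f (Fin.suc i))) →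
                    Linked R (tabulate f)
  linked-tabulate {zero}  f steps = [-]
  linked-tabulate {suc m} f steps = steps Fin.zero ∷ linked-tabulate (f ∘ Fin.suc) (steps ∘ Fin.suc)

  linked-tabulate-∷ʳ : ∀ {m} (f : Fin (suc m) → A) → (∀ i → R (f (inject₁ i)) (f (Fin.suc i))) →
                       ∀ {z} → R (f (fromℕ m)) z → Linked R (tabulate f ∷ʳ z)
  linked-tabulate-∷ʳ {zero}  f steps r = r ∷ [-]
  linked-tabulate-∷ʳ {suc m} f steps r =
    steps Fin.zero ∷ linked-tabulate-∷ʳ (f ∘ Fin.suc) (steps ∘ Fin.suc) r

  linked-lookup : ∀ h t → Linked R (h ∷ t) → ∀ (i : Fin (length t)) →
                  R (lookup (h ∷ t) (inject₁ i)) (lookup (h ∷ t) (Fin.suc i))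
  linked-lookup h (y ∷ t) (r ∷ l) Fin.zero    = r
  linked-lookup h (y ∷ t) (r ∷ l) (Fin.suc i) = linked-lookup y t l i

  linked-lookup-last : ∀ h t {z} → Linked R (h ∷ t ∷ʳ z) → R (lookup (h ∷ t) (fromℕ (length t))) z
  linked-lookup-last h []      (r ∷ _) = r
  linked-lookup-last h (y ∷ t) (_ ∷ l) = linked-lookup-last y t l

even-or-even-suc : ∀ m → Even m ⊎ Even (suc m)
even-or-even-suc zero    = inj₁ (divides 0 refl)
even-or-even-suc (suc m) = [ (λ 2∣m → inj₂ (∣m∣n⇒∣m+n (n∣n {2}) 2∣m)) , inj₁ ]′ (even-or-even-suc m)

one-even : ∀ L₁ L₂ i b → L₁ + L₂ ≡ 2 * i + b → Odd b → Even L₁ ⊎ Even L₂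
one-even L₁ L₂ i b L₁+L₂≡ odd-b with 2 ∣? L₁ | 2 ∣? L₂
... | yes 2∣L₁ | _        = inj₁ 2∣L₁
... | no _     | yes 2∣L₂ = inj₂ 2∣L₂
... | no ¬2∣L₁ | no ¬2∣L₂ = ⊥-elim (odd-b (∣m+n∣m⇒∣n 2∣2i+b (m∣m*n i)))
  where
  even-suc : ∀ {m} → Odd m → Even (suc m)
  even-suc {m} odd-m = [ ⊥-elim ∘ odd-m , id ]′ (even-or-even-suc m)
  2∣2+L₁+L₂ : Even (2 + (L₁ + L₂))
  2∣2+L₁+L₂ = subst Even (ℕ.+-suc (suc L₁) L₂) (∣m∣n⇒∣m+n (even-suc ¬2∣L₁) (even-suc ¬2∣L₂))
  2∣2i+b : Even (2 * i + b)
  2∣2i+b = subst Even L₁+L₂≡ (∣m+n∣m⇒∣n 2∣2+L₁+L₂ (n∣n {2}))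

module Decompositions {A : Set} (_≟_ : DecidableEquality A) where
  open import Data.List.Membership.DecPropositional _≟_ using (_∈?_)

  disjoint-∷ : ∀ {x : A} {xs X} → x ∉ X → Disjoint xs X → Disjoint (x ∷ xs) X
  disjoint-∷ x∉X xs#X (here refl , x∈X) = x∉X x∈X
  disjoint-∷ x∉X xs#X (there v∈xs , v∈X) = xs#X (v∈xs , v∈X)

  first-in : ∀ X xs → Disjoint xs X ⊎
             Σ[ B ∈ List A ] Σ[ y ∈ A ] Σ[ C ∈ List A ] (xs ≡ B ++ y ∷ C × y ∈ X × Disjoint B X)
  first-in X [] = inj₁ λ { (() , _) }
  first-in X (x ∷ xs) with x ∈? X
  ... | yes x∈X = inj₂ ([] , x , xs , refl , x∈X , λ { (() , _) })
  ... | no x∉X with first-in X xs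
  ...   | inj₁ xs#X = inj₁ (disjoint-∷ x∉X xs#X)
  ...   | inj₂ (B , y , C , refl , y∈X , B#X) =
          inj₂ (x ∷ B , y , C , refl , y∈X , disjoint-∷ x∉X B#X)

  last-in : ∀ X xs → Disjoint xs X ⊎
            Σ[ B ∈ List A ] Σ[ y ∈ A ] Σ[ C ∈ List A ] (xs ≡ B ++ y ∷ C × y ∈ X × Disjoint C X)
  last-in X [] = inj₁ λ { (() , _) }
  last-in X (x ∷ xs) with last-in X xs
  ... | inj₂ (B , y , C , refl , y∈X , C#X) = inj₂ (x ∷ B , y , C , refl , y∈X , C#X)
  ... | inj₁ xs#X with x ∈? X
  ...   | yes x∈X = inj₂ ([] , x , xs , refl , x∈X , xs#X)
  ...   | no x∉X  = inj₁ (disjoint-∷ x∉X xs#X)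

  module _ {R : A → A → Set} where

    record Crossing (X Y : List A) : Set where
      field
        start end : A
        interior  : List A
        start∈X   : start ∈ X
        end∈Y     : end ∈ Y
        walk      : Linked R (start ∷ interior ∷ʳ end)
        avoids-X  : Disjoint interior X
        avoids-Y  : Disjoint interior Y

    -- A walk that starts in X and meets the disjoint set Y contains a crossing from X to Y:
    -- cut it at its first vertex in Y, then at the last vertex in X before that.
    crossing : ∀ {X Y s W} → Disjoint X Y → Linked R (s ∷ W) → s ∈ X → Any (_∈ Y) (s ∷ W) →
               Crossing X Y
    crossing X#Y _ s∈X (here s∈Y) = ⊥-elim (X#Y (s∈X , s∈Y))
    crossing {X} {Y} {s} {W} X#Y l s∈X (there meets-Y) with first-in Y W
    ... | inj₁ W#Y = ⊥-elim (W#Y (proj₂ (find meets-Y)))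
    ... | inj₂ (B , y , C , refl , y∈Y , B#Y) with last-in X (s ∷ B)
    ...   | inj₁ sB#X = ⊥-elim (sB#X (here refl , s∈X))
    ...   | inj₂ (D , x , E , sB≡ , x∈X , E#X) = record
      { start = x ; end = y ; interior = E ; start∈X = x∈X ; end∈Y = y∈Y
      ; walk = linked-suffix D (subst (Linked R) (trans (cong (_∷ʳ y) sB≡) (++-assoc D (x ∷ E) (y ∷ [])))
                                       (linked-prefix (s ∷ B) l))
      ; avoids-X = E#X ; avoids-Y = E#Y }
      where
      E⊆sB : E ⊆ s ∷ B
      E⊆sB {v} v∈E = subst (v ∈_) (sym sB≡) (∈-++⁺ʳ D (there v∈E))
      sB#Y : Disjoint (s ∷ B) Y
      sB#Y (here refl , v∈Y) = X#Y (s∈X , v∈Y)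
      sB#Y (there v∈B , v∈Y) = B#Y (v∈B , v∈Y)
      E#Y : Disjoint E Y
      E#Y (v∈E , v∈Y) = sB#Y (E⊆sB v∈E , v∈Y)

    -- A walk meeting both of two disjoint sets contains a crossing between them, in one direction
    -- or the other: start from its first vertex lying in either set.
    crossing-between : ∀ {X Y w} → Disjoint X Y → Linked R w → Any (_∈ X) w → Any (_∈ Y) w →
                       Crossing X Y ⊎ Crossing Y X
    crossing-between {X} {Y} {v ∷ w} X#Y l meets-X meets-Y with v ∈? X | v ∈? Y
    ... | yes v∈X | _       = inj₁ (crossing X#Y l v∈X meets-Y)
    ... | no _    | yes v∈Y = inj₂ (crossing (Disjoint.sym X#Y) l v∈Y meets-X)
    ... | no v∉X  | no v∉Y  = crossing-between X#Y (tail l) (skip v∉X meets-X) (skip v∉Y meets-Y)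
      where
      skip : ∀ {Z} → v ∉ Z → Any (_∈ Z) (v ∷ w) → Any (_∈ Z) w
      skip v∉Z (here v∈Z)  = ⊥-elim (v∉Z v∈Z)
      skip v∉Z (there any) = any

    erase-loops : ∀ s W {z} → s ≢ z → Linked R (s ∷ W ∷ʳ z) →
                  Σ[ I ∈ List A ] (Linked R (s ∷ I ∷ʳ z) × Unique (s ∷ I ∷ʳ z) × I ⊆ W)
    erase-loops s [] s≢z l = [] , l , unique-pair s≢z , λ ()
    erase-loops s (w ∷ W) {z} s≢z (r ∷ l) with w ≟ z
    ... | yes refl = [] , r ∷ [-] , unique-pair s≢z , λ ()
    ... | no w≢z with erase-loops w W w≢z l
    ...   | I , lI , uI , I⊆W with s ∈? (w ∷ I)
    ...     | no s∉wI = w ∷ I , r ∷ lI , unique-∷ s∉wIz uI , ∷⁺ʳ w I⊆W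
      where
      s∉wIz : s ∉ w ∷ I ∷ʳ z
      s∉wIz s∈ = [ s∉wI , (λ { (here s≡z) → s≢z s≡z }) ]′ (∈-++⁻ (w ∷ I) s∈)
    ...     | yes s∈wI with ∈-∃++ s∈wI
    ...       | P , Q , wI≡ = Q , linked-suffix P (subst (Linked R) shortcut lI)
                              , unique-++⁻ʳ P (subst Unique shortcut uI) , Q⊆wW
      where
      -- the path from w returns to s; keep only the part after that visit
      shortcut : w ∷ I ∷ʳ z ≡ P ++ s ∷ Q ∷ʳ z
      shortcut = trans (cong (_∷ʳ z) wI≡) (++-assoc P (s ∷ Q) (z ∷ []))
      Q⊆wW : Q ⊆ w ∷ W
      Q⊆wW {v} v∈Q = ∷⁺ʳ w I⊆W (subst (v ∈_) (sym wI≡) (∈-++⁺ʳ P (there v∈Q)))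

module CycleLists {n : ℕ} (H : Graph n) where

  V : Set
  V = Fin n

  open Decompositions (Fin._≟_ {n})

  IsWalk : List V → Set
  IsWalk = Linked (Adj H)

  close : List V → List V
  close []      = []
  close (h ∷ t) = h ∷ t ∷ʳ h

  record IsCycle (cs : List V) : Set where
    field
      closed   : IsWalk (close cs)
      distinct : Unique cs
      long     : 3 ≤ length cs
  open IsCycle public

  rotate-closed : ∀ P Q → IsWalk (close (P ++ Q)) → IsWalk (close (Q ++ P))
  rotate-closed []      Q l = subst (IsWalk ∘ close) (sym (++-identityʳ Q)) l
  rotate-closed (p ∷ P) [] l = subst (IsWalk ∘ close) (++-identityʳ (p ∷ P)) l
  rotate-closed (p ∷ P) (q ∷ Q) l =
    subst IsWalk (cong (q ∷_) (sym (++-assoc Q (p ∷ P) (q ∷ []))))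
      (linked-join (q ∷ Q) (linked-suffix (p ∷ P) l′) (linked-prefix (p ∷ P) l′))
    where
    l′ : IsWalk ((p ∷ P) ++ q ∷ (Q ∷ʳ p))
    l′ = subst IsWalk (cong (p ∷_) (++-assoc P (q ∷ Q) (p ∷ []))) l

  rotate-cycle : ∀ {cs ds} → Rotation cs ds → IsCycle cs → IsCycle ds
  rotate-cycle ρ@(rotation P Q) cyc = record
    { closed   = rotate-closed P Q (closed cyc)
    ; distinct = Unique.++⁺ (unique-++⁻ʳ P (distinct cyc)) (unique-++⁻ˡ P (distinct cyc))
                   (Disjoint.sym (unique-++⁻-disjoint P (distinct cyc)))
    ; long     = subst (3 ≤_) (sym (rotation-length ρ)) (long cyc) }

  data Consecutive : List V → V → V → Set where
    here  : ∀ {a b xs} → Consecutive (a ∷ b ∷ xs) a b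
    there : ∀ {a b x xs} → Consecutive xs a b → Consecutive (x ∷ xs) a b

  EdgeOf : List V → V → V → Set
  EdgeOf cs a b = Consecutive (close cs) a b ⊎ Consecutive (close cs) b a

  consecutive-split : ∀ {xs a b} → Consecutive xs a b →
                      Σ[ P ∈ List V ] Σ[ Q ∈ List V ] (xs ≡ P ++ a ∷ b ∷ Q)
  consecutive-split {a ∷ b ∷ xs} here = [] , xs , refl
  consecutive-split {x ∷ xs} (there c) with consecutive-split c
  ... | P , Q , refl = x ∷ P , Q , refl

  consecutive-++ : ∀ P {a b Q} → Consecutive (P ++ a ∷ b ∷ Q) a b
  consecutive-++ []      = here
  consecutive-++ (x ∷ P) = there (consecutive-++ P)

  consecutive-close : ∀ P {a b Q} → Consecutive (close (P ++ a ∷ b ∷ Q)) a b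
  consecutive-close []                = here
  consecutive-close (p ∷ P) {a} {b} {Q} =
    there (subst (λ zs → Consecutive zs a b) (sym (++-assoc P (a ∷ b ∷ Q) (p ∷ []))) (consecutive-++ P))

  consecutive-closing : ∀ x M y → Consecutive (close (x ∷ M ++ y ∷ [])) y x
  consecutive-closing x M y =
    there (subst (λ zs → Consecutive zs y x) (sym (++-assoc M (y ∷ []) (x ∷ []))) (consecutive-++ M))

  consecutive-∷ʳ : ∀ xs {z a b} → Consecutive (xs ∷ʳ z) a b →
                   Consecutive xs a b ⊎ (b ≡ z × Σ[ P ∈ List V ] (xs ≡ P ∷ʳ a))
  consecutive-∷ʳ []           (there ())
  consecutive-∷ʳ (x ∷ [])     here              = inj₂ (refl , [] , refl)
  consecutive-∷ʳ (x ∷ [])     (there (there ()))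
  consecutive-∷ʳ (x ∷ y ∷ xs) here              = inj₁ here
  consecutive-∷ʳ (x ∷ y ∷ xs) (there c) with consecutive-∷ʳ (y ∷ xs) c
  ... | inj₁ c′                 = inj₁ (there c′)
  ... | inj₂ (refl , P , yxs≡) = inj₂ (refl , x ∷ P , cong (x ∷_) yxs≡)

  closing-rotation : ∀ {cs a b} → IsCycle cs → Consecutive (close cs) a b →
                     Σ[ T ∈ List V ] Rotation cs (b ∷ T ∷ʳ a)
  closing-rotation {h ∷ t} {a} {b} cyc c with consecutive-∷ʳ (h ∷ t) c
  ... | inj₁ c′ with consecutive-split c′
  ...   | P , Q , ht≡ = Q ++ P ,
          rotation′ (P ∷ʳ a) (b ∷ Q) (trans ht≡ (sym (++-assoc P (a ∷ []) (b ∷ Q))))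
                                     (cong (b ∷_) (++-assoc Q P (a ∷ [])))
  closing-rotation {h ∷ t} cyc c | inj₂ (refl , [] , refl) with long cyc
  ... | s≤s ()
  closing-rotation {h ∷ t} cyc c | inj₂ (refl , p ∷ T , refl) =
    T , rotation′ [] (h ∷ t) refl (sym (++-identityʳ (h ∷ t)))

  consecutive? : ∀ xs a b → Dec (Consecutive xs a b)
  consecutive? []           a b = no λ ()
  consecutive? (x ∷ [])     a b = no λ { (there ()) }
  consecutive? (x ∷ y ∷ xs) a b with x Fin.≟ a | y Fin.≟ b | consecutive? (y ∷ xs) a b
  ... | yes refl | yes refl | _      = yes here
  ... | _        | _        | yes c  = yes (there c)
  ... | no x≢a   | _        | no ¬c  = no λ { here → x≢a refl ; (there c) → ¬c c }
  ... | yes _    | no y≢b   | no ¬c  = no λ { here → y≢b refl ; (there c) → ¬c c }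

  edge-of? : ∀ cs a b → Dec (EdgeOf cs a b)
  edge-of? cs a b = consecutive? (close cs) a b ⊎-dec consecutive? (close cs) b a

  record Ear (cs : List V) (x : V) (I : List V) (y : V) : Set where
    field
      ear-walk  : IsWalk (x ∷ I ∷ʳ y)
      ear-path  : Unique (x ∷ I ∷ʳ y)
      ear-avoid : Disjoint I cs
  open Ear public

  ear-⊆ : ∀ {cs ds x I y} → ds ⊆ cs → Ear cs x I y → Ear ds x I y
  ear-⊆ ds⊆cs ear = record
    { ear-walk = ear-walk ear ; ear-path = ear-path ear
    ; ear-avoid = λ { (v∈I , v∈ds) → ear-avoid ear (v∈I , ds⊆cs v∈ds) } }

  reverse-path : ∀ (x : V) I y → reverse (x ∷ I ∷ʳ y) ≡ y ∷ reverse I ∷ʳ x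
  reverse-path x I y = begin
    reverse (x ∷ I ∷ʳ y)      ≡⟨ unfold-reverse x (I ∷ʳ y) ⟩
    reverse (I ∷ʳ y) ∷ʳ x     ≡⟨ cong (_∷ʳ x) (reverse-++ I (y ∷ [])) ⟩
    y ∷ reverse I ∷ʳ x        ∎
    where open ≡-Reasoning

  ear-reverse : ∀ {cs x I y} → Ear cs x I y → Ear cs y (reverse I) x
  ear-reverse {x = x} {I} {y} ear = record
    { ear-walk  = subst IsWalk (reverse-path x I y) (linked-reverse (Graph.sym H) (ear-walk ear))
    ; ear-path  = subst Unique (reverse-path x I y) (unique-reverse (ear-path ear))
    ; ear-avoid = λ { (v∈I , v∈cs) → ear-avoid ear (Any.reverse⁻ v∈I , v∈cs) } }

  reroute : ∀ {x M y K I} → IsCycle (x ∷ M ++ y ∷ K) → Ear (x ∷ M ++ y ∷ K) x I y →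
            3 ≤ length (x ∷ I ++ y ∷ K) → IsCycle (x ∷ I ++ y ∷ K)
  reroute {x} {M} {y} {K} {I} cyc ear long′ = record
    { closed   = subst IsWalk (cong (x ∷_) (sym (++-assoc I (y ∷ K) (x ∷ []))))
                   (linked-join (x ∷ I) (ear-walk ear) (linked-suffix (x ∷ M) closed′))
    ; distinct = Unique.++⁺ (unique-++⁻ˡ (x ∷ I) (ear-path ear)) (unique-++⁻ʳ (x ∷ M) (distinct cyc))
                            xI#yK
    ; long     = long′ }
    where
    closed′ : IsWalk ((x ∷ M) ++ y ∷ (K ∷ʳ x))
    closed′ = subst IsWalk (cong (x ∷_) (++-assoc M (y ∷ K) (x ∷ []))) (closed cyc)
    xI#yK : Disjoint (x ∷ I) (y ∷ K)
    xI#yK (here refl , x∈yK) = Unique[x∷xs]⇒x∉xs (distinct cyc) (∈-++⁺ʳ M x∈yK)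
    xI#yK (there v∈I , v∈yK) = ear-avoid ear (v∈I , there (∈-++⁺ʳ M v∈yK))

  NoEvenCycle : Set
  NoEvenCycle = ∀ {cs} → IsCycle cs → ¬ Even (length cs)

  length-∷-++-∷ : ∀ (x : V) I y K → length (x ∷ I ++ y ∷ K) ≡ suc (length I + suc (length K))
  length-∷-++-∷ x I y K = cong suc (length-++ I)

  three-≤ : ∀ (x : V) I y K → 1 ≤ length I + length K → 3 ≤ length (x ∷ I ++ y ∷ K)
  three-≤ x I y K 1≤ = subst (3 ≤_) (sym (length-∷-++-∷ x I y K))
                         (s≤s (subst (2 ≤_) (sym (ℕ.+-suc (length I) (length K))) (s≤s 1≤)))

  ear-cycles-length : ∀ (x : V) M y K I →
    length (x ∷ I ++ y ∷ K) + length (y ∷ reverse I ++ x ∷ M) ≡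
    2 * suc (length I) + length (x ∷ M ++ y ∷ K)
  ear-cycles-length x M y K I = begin
    length (x ∷ I ++ y ∷ K) + length (y ∷ reverse I ++ x ∷ M)
      ≡⟨ cong₂ _+_ (length-∷-++-∷ x I y K)
                   (trans (length-∷-++-∷ y (reverse I) x M)
                          (cong (λ ℓ → suc (ℓ + _)) (length-reverse I))) ⟩
    suc (length I + suc (length K)) + suc (length I + suc (length M))
      ≡⟨ arithmetic (length I) (length M) (length K) ⟩
    2 * suc (length I) + suc (length M + suc (length K))
      ≡⟨ cong (2 * suc (length I) +_) (sym (length-∷-++-∷ x M y K)) ⟩
    2 * suc (length I) + length (x ∷ M ++ y ∷ K) ∎
    where
    open ≡-Reasoning
    arithmetic : ∀ i m k → suc (i + suc k) + suc (i + suc m) ≡ 2 * suc i + suc (m + suc k)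
    arithmetic = solve-∀

  -- If the ear and both arcs are long enough to close up into cycles, the two cycles
  -- have odd total length, so one of them is even.
  two-ear-cycles : NoEvenCycle → ∀ {x M y K I} → IsCycle (x ∷ M ++ y ∷ K) →
                   Odd (length (x ∷ M ++ y ∷ K)) → Ear (x ∷ M ++ y ∷ K) x I y →
                   1 ≤ length I + length K → 1 ≤ length I + length M → ⊥
  two-ear-cycles no-even {x} {M} {y} {K} {I} cyc odd ear long₁ long₂ =
    [ no-even cyc₁ , no-even cyc₂ ]′ (one-even _ _ (suc (length I)) _ (ear-cycles-length x M y K I) odd)
    where
    cyc₁ : IsCycle (x ∷ I ++ y ∷ K)
    cyc₁ = reroute cyc ear (three-≤ x I y K long₁)
    cyc₂ : IsCycle (y ∷ reverse I ++ x ∷ M)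
    cyc₂ = reroute (rotate-cycle (rotation (x ∷ M) (y ∷ K)) cyc)
                   (ear-⊆ (rotation-⊆ (rotation (y ∷ K) (x ∷ M))) (ear-reverse ear))
                   (three-≤ y (reverse I) x M
                     (subst (λ ℓ → 1 ≤ ℓ + length M) (sym (length-reverse I)) long₂))

  ear-is-edge′ : NoEvenCycle → ∀ {x M y K I} → IsCycle (x ∷ M ++ y ∷ K) → Odd (length (x ∷ M ++ y ∷ K)) →
                 Ear (x ∷ M ++ y ∷ K) x I y → I ≡ [] × (M ≡ [] ⊎ K ≡ [])
  ear-is-edge′ no-even {M = []}    {I = []}    _ _ _ = refl , inj₁ refl
  ear-is-edge′ no-even {K = []}    {I = []}    _ _ _ = refl , inj₂ refl
  ear-is-edge′ no-even {M = _ ∷ _} {K = _ ∷ _} {I = []} cyc odd ear =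
    ⊥-elim (two-ear-cycles no-even cyc odd ear (s≤s z≤n) (s≤s z≤n))
  ear-is-edge′ no-even {I = _ ∷ _} cyc odd ear =
    ⊥-elim (two-ear-cycles no-even cyc odd ear (s≤s z≤n) (s≤s z≤n))

  adjacent-on-cycle : ∀ P N {x M y} → M ≡ [] ⊎ N ++ P ≡ [] → EdgeOf (P ++ x ∷ M ++ y ∷ N) x y
  adjacent-on-cycle P N (inj₁ refl) = inj₁ (consecutive-close P)
  adjacent-on-cycle P N (inj₂ NP≡[]) with ++-conicalˡ N P NP≡[] | ++-conicalʳ N P NP≡[]
  ... | refl | refl = inj₂ (consecutive-closing _ _ _)

  ear-ends-distinct : ∀ {cs x I y} → Ear cs x I y → x ≢ y
  ear-ends-distinct {I = I} ear refl = Unique[x∷xs]⇒x∉xs (ear-path ear) (∈-++⁺ʳ I (here refl))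

  ear-is-edge-ordered : NoEvenCycle → ∀ P M N {x y I} → let cs = P ++ x ∷ M ++ y ∷ N in
                        IsCycle cs → Odd (length cs) → Ear cs x I y → I ≡ [] × EdgeOf cs x y
  ear-is-edge-ordered no-even P M N {x} {y} cyc odd ear =
    let I≡[] , arc-empty = ear-is-edge′ no-even (rotate-cycle ρ cyc) (subst Odd (sym (rotation-length ρ)) odd)
                                        (ear-⊆ (rotation-⊆ (rotation-sym ρ)) ear)
    in I≡[] , adjacent-on-cycle P N arc-empty
    where
    ρ : Rotation (P ++ x ∷ M ++ y ∷ N) (x ∷ M ++ y ∷ (N ++ P))
    ρ = rotation′ P (x ∷ M ++ y ∷ N) refl (cong (x ∷_) (sym (++-assoc M (y ∷ N) P)))

  ear-is-edge : NoEvenCycle → ∀ {cs x I y} → IsCycle cs → Odd (length cs) → x ∈ cs → y ∈ cs →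
                Ear cs x I y → I ≡ [] × EdgeOf cs x y
  ear-is-edge no-even cyc odd x∈cs y∈cs ear with two-positions x∈cs y∈cs (ear-ends-distinct ear)
  ... | inj₁ (P , M , N , refl) = ear-is-edge-ordered no-even P M N cyc odd ear
  ... | inj₂ (P , M , N , refl) with ear-is-edge-ordered no-even P M N cyc odd (ear-reverse ear)
  ...   | reverse-I≡[] , edge = reverse-injective reverse-I≡[] , swap edge

  -- The cycles s ∷ t₁ and z ∷ t₂ form a dumbbell: either they share exactly one vertex (their
  -- common first vertex), or they are disjoint and joined by a path s ∷ I ∷ʳ z between their
  -- first vertices whose interior avoids both.
  data Dumbbell : V → List V → V → List V → Set where
    touching : ∀ {h t₁ t₂} → Disjoint t₁ t₂ → Dumbbell h t₁ h t₂
    joined   : ∀ {s t₁ z t₂} → Disjoint (s ∷ t₁) (z ∷ t₂) → ∀ I → Ear ((s ∷ t₁) ++ (z ∷ t₂)) s I z →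
               Dumbbell s t₁ z t₂

  NoOddDumbbell : Set
  NoOddDumbbell = ∀ {s t₁ z t₂} → IsCycle (s ∷ t₁) → IsCycle (z ∷ t₂) →
                  Odd (length (s ∷ t₁)) → Odd (length (z ∷ t₂)) → ¬ Dumbbell s t₁ z t₂

  rotate-odd-cycle : ∀ {cs ds} → Rotation cs ds → IsCycle cs → Odd (length cs) →
                     IsCycle ds × Odd (length ds)
  rotate-odd-cycle ρ cyc odd = rotate-cycle ρ cyc , subst Odd (sym (rotation-length ρ)) odd

  odd-cycle-to-front : ∀ {cs x} → IsCycle cs → Odd (length cs) → x ∈ cs →
                       Σ[ t ∈ List V ] (Rotation cs (x ∷ t) × IsCycle (x ∷ t) × Odd (length (x ∷ t)))
  odd-cycle-to-front cyc odd x∈cs with to-front x∈cs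
  ... | t , ρ = t , ρ , rotate-odd-cycle ρ cyc odd

  -- A crossing from one odd cycle to a disjoint one yields an odd dumbbell: erase the
  -- loops of the crossing and rotate both cycles to start at its endpoints.
  crossing-dumbbell : NoOddDumbbell → ∀ {cs ds} → IsCycle cs → IsCycle ds → Odd (length cs) →
                      Odd (length ds) → Disjoint cs ds → Crossing {R = Adj H} cs ds → ⊥
  crossing-dumbbell no-dumbbell {cs} {ds} cyc₁ cyc₂ odd₁ odd₂ cs#ds
    record { start = s ; end = z ; interior = W ; start∈X = s∈cs ; end∈Y = z∈ds
           ; walk = W-walk ; avoids-X = W#cs ; avoids-Y = W#ds }
    with erase-loops s W (λ { refl → cs#ds (s∈cs , z∈ds) }) W-walk
       | odd-cycle-to-front cyc₁ odd₁ s∈cs | odd-cycle-to-front cyc₂ odd₂ z∈ds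
  ... | I , I-walk , I-path , I⊆W | t₁ , ρ₁ , cyc₁′ , odd₁′ | t₂ , ρ₂ , cyc₂′ , odd₂′ =
    no-dumbbell cyc₁′ cyc₂′ odd₁′ odd₂′ (joined c₁#c₂ I ear)
    where
    c₁#c₂ : Disjoint (s ∷ t₁) (z ∷ t₂)
    c₁#c₂ (v∈₁ , v∈₂) = cs#ds (rotation-⊇ ρ₁ v∈₁ , rotation-⊇ ρ₂ v∈₂)
    ear : Ear ((s ∷ t₁) ++ (z ∷ t₂)) s I z
    ear = record
      { ear-walk = I-walk ; ear-path = I-path
      ; ear-avoid = λ (v∈I , v∈) → [ (λ v∈₁ → W#cs (I⊆W v∈I , rotation-⊇ ρ₁ v∈₁))
                                   , (λ v∈₂ → W#ds (I⊆W v∈I , rotation-⊇ ρ₂ v∈₂)) ]′ (∈-++⁻ (s ∷ t₁) v∈) }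

  disjoint-joined : NoOddDumbbell → ∀ {cs ds w} → IsCycle cs → IsCycle ds → Odd (length cs) →
                    Odd (length ds) → Disjoint cs ds → IsWalk w → Any (_∈ cs) w → Any (_∈ ds) w → ⊥
  disjoint-joined no-dumbbell cyc₁ cyc₂ odd₁ odd₂ cs#ds walk meets-cs meets-ds
    with crossing-between cs#ds walk meets-cs meets-ds
  ... | inj₁ cr = crossing-dumbbell no-dumbbell cyc₁ cyc₂ odd₁ odd₂ cs#ds cr
  ... | inj₂ cr = crossing-dumbbell no-dumbbell cyc₂ cyc₁ odd₂ odd₁ (Disjoint.sym cs#ds) cr

  single-meeting : NoOddDumbbell → ∀ {cs ds A y R} → IsCycle cs → IsCycle ds → Odd (length cs) →
                   Odd (length ds) → cs ≡ A ++ y ∷ R → y ∈ ds → Disjoint A ds → Disjoint R ds → ⊥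
  single-meeting no-dumbbell {cs} {ds} {A} {y} {R} cyc₁ cyc₂ odd₁ odd₂ cs≡ y∈ds A#ds R#ds
    with rotate-odd-cycle (rotation′ A (y ∷ R) cs≡ refl) cyc₁ odd₁ | odd-cycle-to-front cyc₂ odd₂ y∈ds
  ... | cyc₁′ , odd₁′ | t₂ , ρ₂ , cyc₂′ , odd₂′ = no-dumbbell cyc₁′ cyc₂′ odd₁′ odd₂′ (touching RA#t₂)
    where
    RA#t₂ : Disjoint (R ++ A) t₂
    RA#t₂ = disjoint-++ (λ (v∈R , v∈t₂) → R#ds (v∈R , rotation-⊇ ρ₂ (there v∈t₂)))
                        (λ (v∈A , v∈t₂) → A#ds (v∈A , rotation-⊇ ρ₂ (there v∈t₂)))

  wrap-around-ear : ∀ {cs ds A y B x D} → IsCycle cs → cs ≡ A ++ y ∷ B ++ x ∷ D →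
                    Disjoint A ds → Disjoint D ds → Ear ds x (D ++ A) y
  wrap-around-ear {cs} {ds} {A} {y} {B} {x} {D} cyc cs≡ A#ds D#ds = record
    { ear-walk  = linked-prefix (x ∷ (D ++ A)) (subst IsWalk
        (solve 5 (λ X D A Y B → X ⊕ ((D ⊕ (A ⊕ (Y ⊕ B))) ⊕ X) ⊜ (X ⊕ (D ⊕ A)) ⊕ (Y ⊕ (B ⊕ X)))
               refl (x ∷ []) D A (y ∷ []) B)
        (closed cyc′))
    ; ear-path  = unique-++⁻ˡ (x ∷ (D ++ A) ∷ʳ y) (subst Unique
        (solve 5 (λ X D A Y B → (X ⊕ D) ⊕ (A ⊕ (Y ⊕ B)) ⊜ ((X ⊕ (D ⊕ A)) ⊕ Y) ⊕ B)
               refl (x ∷ []) D A (y ∷ []) B)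
        (distinct cyc′))
    ; ear-avoid = disjoint-++ D#ds A#ds }
    where
    open MonoidSolver (++-monoid V) using (solve; _⊜_; _⊕_)
    cyc′ : IsCycle ((x ∷ D) ++ (A ++ y ∷ B))
    cyc′ = rotate-cycle (rotation′ (A ++ y ∷ B) (x ∷ D) (trans cs≡ (sym (++-assoc A (y ∷ B) (x ∷ D)))) refl)
                        cyc

  -- If the closing edge ab of the odd cycle b ∷ T ∷ʳ a is not an edge of the odd cycle ds, the
  -- first cycle cannot leave ds at x and return at y through that edge (b ∷ T ∷ʳ a being
  -- A ++ y ∷ B ++ x ∷ D with A, D off ds): that arc would be an ear of ds, hence an edge of ds,
  -- forcing x = a and y = b.
  closing-edge-ear : NoEvenCycle → ∀ {a b T ds A y B x D} → IsCycle (b ∷ T ∷ʳ a) → IsCycle ds →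
                     Odd (length ds) → ¬ EdgeOf ds a b → b ∷ T ∷ʳ a ≡ A ++ y ∷ B ++ x ∷ D →
                     y ∈ ds → x ∈ ds → Disjoint A ds → Disjoint D ds → ⊥
  closing-edge-ear no-even {A = A} {y} {B} {x} {D} cyc₁ cyc₂ odd₂ ¬ab cs≡ y∈ds x∈ds A#ds D#ds
    with ear-is-edge no-even cyc₂ odd₂ x∈ds y∈ds (wrap-around-ear cyc₁ cs≡ A#ds D#ds)
  ... | DA≡[] , xy with first-and-last A y B x D cs≡ DA≡[]
  ...   | refl , refl = ¬ab xy

  -- Cases: the cycles are
  -- disjoint, meet in a single vertex, or the first cycle returns to ds through the edge ab.
  closing-edge-shared : NoEvenCycle → NoOddDumbbell → ∀ {a b T ds w} →
                        IsCycle (b ∷ T ∷ʳ a) → IsCycle ds → Odd (length (b ∷ T ∷ʳ a)) →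
                        Odd (length ds) → IsWalk w → Any (_∈ b ∷ T ∷ʳ a) w → Any (_∈ ds) w →
                        ¬ EdgeOf ds a b → ⊥
  closing-edge-shared no-even no-dumbbell {a} {b} {T} {ds} cyc₁ cyc₂ odd₁ odd₂ walk meets-cs meets-ds ¬ab
    with first-in ds (b ∷ T ∷ʳ a)
  ... | inj₁ cs#ds = disjoint-joined no-dumbbell cyc₁ cyc₂ odd₁ odd₂ cs#ds walk meets-cs meets-ds
  ... | inj₂ (A , y , R , cs≡ , y∈ds , A#ds) with last-in ds R
  ...   | inj₁ R#ds = single-meeting no-dumbbell cyc₁ cyc₂ odd₁ odd₂ cs≡ y∈ds A#ds R#ds
  ...   | inj₂ (B , x , D , refl , x∈ds , D#ds) =
          closing-edge-ear no-even cyc₁ cyc₂ odd₂ ¬ab cs≡ y∈ds x∈ds A#ds D#ds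

  edges-shared : NoEvenCycle → NoOddDumbbell → ∀ {cs ds w a b} → IsCycle cs → IsCycle ds →
                 Odd (length cs) → Odd (length ds) → IsWalk w → Any (_∈ cs) w → Any (_∈ ds) w →
                 EdgeOf cs a b → EdgeOf ds a b
  edges-shared no-even no-dumbbell {cs} {ds} {a = a} {b} cyc₁ cyc₂ odd₁ odd₂ walk meets-cs meets-ds ab
    with edge-of? ds a b
  ... | yes ab∈ds = ab∈ds
  ... | no ab∉ds  = ⊥-elim ([ (λ c → via-closing c ab∉ds) , (λ c → via-closing c (ab∉ds ∘ swap)) ]′ ab)
    where
    -- rotate cs so that the edge u → v becomes its closing edge
    via-closing : ∀ {u v} → Consecutive (close cs) u v → ¬ EdgeOf ds u v → ⊥
    via-closing c uv∉ds with closing-rotation cyc₁ c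
    ... | T , ρ = let cyc₁′ , odd₁′ = rotate-odd-cycle ρ cyc₁ odd₁ in
      closing-edge-shared no-even no-dumbbell cyc₁′ cyc₂ odd₁′ odd₂ walk (Any-map (rotation-⊆ ρ) meets-cs)
                          meets-ds uv∉ds

module Conversions {n : ℕ} (H : Graph n) where
  open CycleLists H

  consecutive-tabulate : ∀ {m} (f : Fin (suc m) → V) z (i : Fin m) →
                         Consecutive (tabulate f ∷ʳ z) (f (inject₁ i)) (f (Fin.suc i))
  consecutive-tabulate {suc m} f z Fin.zero    = here
  consecutive-tabulate {suc m} f z (Fin.suc i) = there (consecutive-tabulate (f ∘ Fin.suc) z i)

  consecutive-tabulate-last : ∀ {m} (f : Fin (suc m) → V) z →
                              Consecutive (tabulate f ∷ʳ z) (f (fromℕ m)) z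
  consecutive-tabulate-last {zero}  f z = here
  consecutive-tabulate-last {suc m} f z = there (consecutive-tabulate-last (f ∘ Fin.suc) z)

  consecutive-tabulate⁻ : ∀ {m} (f : Fin (suc m) → V) z {a b} → Consecutive (tabulate f ∷ʳ z) a b →
    (∃[ i ] (f (inject₁ i) ≡ a × f (Fin.suc i) ≡ b)) ⊎ (f (fromℕ m) ≡ a × z ≡ b)
  consecutive-tabulate⁻ {zero}  f z here               = inj₂ (refl , refl)
  consecutive-tabulate⁻ {zero}  f z (there (there ()))
  consecutive-tabulate⁻ {suc m} f z here               = inj₁ (Fin.zero , refl , refl)
  consecutive-tabulate⁻ {suc m} f z (there c) with consecutive-tabulate⁻ (f ∘ Fin.suc) z c
  ... | inj₁ (i , fi≡a , fi+1≡b) = inj₁ (Fin.suc i , fi≡a , fi+1≡b)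
  ... | inj₂ last≡               = inj₂ last≡

  unique-length : ∀ {xs : List V} → Unique xs → length xs ≤ n
  unique-length u = Fin.injective⇒≤ (unique-lookup-injective u)

  module _ {m : ℕ} (C : Cycle H m) where

    cycle-list : List V
    cycle-list = tabulate (vtx C)

    cycle-list-length : length cycle-list ≡ suc m
    cycle-list-length = length-tabulate (vtx C)

    cycle-list-isCycle : IsCycle cycle-list
    cycle-list-isCycle = record
      { closed   = linked-tabulate-∷ʳ (vtx C) (step C) (closing C)
      ; distinct = Unique.tabulate⁺ (inj C)
      ; long     = subst (3 ≤_) (sym cycle-list-length) (s≤s (len≥3 C)) }

    cycle-list-odd : Odd (suc m) → Odd (length cycle-list)
    cycle-list-odd = subst Odd (sym cycle-list-length)

    cycleEdge⇒edgeOf : ∀ {u v} → CycleEdge H C u v → EdgeOf cycle-list u v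
    cycleEdge⇒edgeOf (inj₁ (i , inj₁ (refl , refl))) = inj₁ (consecutive-tabulate (vtx C) _ i)
    cycleEdge⇒edgeOf (inj₁ (i , inj₂ (refl , refl))) = inj₂ (consecutive-tabulate (vtx C) _ i)
    cycleEdge⇒edgeOf (inj₂ (inj₁ (refl , refl)))     = inj₁ (consecutive-tabulate-last (vtx C) _)
    cycleEdge⇒edgeOf (inj₂ (inj₂ (refl , refl)))     = inj₂ (consecutive-tabulate-last (vtx C) _)

    edgeOf⇒cycleEdge : ∀ {u v} → EdgeOf cycle-list u v → CycleEdge H C u v
    edgeOf⇒cycleEdge (inj₁ c) with consecutive-tabulate⁻ (vtx C) _ c
    ... | inj₁ (i , eqs) = inj₁ (i , inj₁ eqs)
    ... | inj₂ eqs       = inj₂ (inj₁ eqs)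
    edgeOf⇒cycleEdge (inj₂ c) with consecutive-tabulate⁻ (vtx C) _ c
    ... | inj₁ (i , eqs) = inj₁ (i , inj₂ eqs)
    ... | inj₂ eqs       = inj₂ (inj₂ eqs)

  module _ {u v : V} (wk : Walk H u v) where

    walk-list : List V
    walk-list = tabulate (wvtx wk)

    walk-list-isWalk : IsWalk walk-list
    walk-list-isWalk = linked-tabulate (wvtx wk) (wstep wk)

    walk-list-start : u ∈ walk-list
    walk-list-start = subst (_∈ walk-list) (wstart wk) (∈-tabulate⁺ {f = wvtx wk} Fin.zero)

    walk-list-end : v ∈ walk-list
    walk-list-end = subst (_∈ walk-list) (wend wk) (∈-tabulate⁺ {f = wvtx wk} (fromℕ (wlen wk)))

  toCycle : ∀ h t → IsCycle (h ∷ t) → Cycle H (length t)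
  toCycle h t cyc = record
    { len≥3   = ℕ.≤-pred (long cyc)
    ; vtx     = lookup (h ∷ t)
    ; inj     = unique-lookup-injective (distinct cyc)
    ; step    = linked-lookup h t (linked-init (h ∷ t) (closed cyc))
    ; closing = linked-lookup-last h t (closed cyc) }

  toPath : ∀ h t → IsWalk (h ∷ t) → Unique (h ∷ t) → Path H (length t)
  toPath h t walk u = record
    { pvtx = lookup (h ∷ t) ; pinj = unique-lookup-injective u ; pstep = linked-lookup h t walk }

module InFk {n : ℕ} (H : Graph n) (k : ℕ) (n≤2k : n ≤ 2 * k) where
  open CycleLists H
  open Conversions H

  -- A cycle has at most n ≤ 2k vertices, so an even cycle is a member of 𝓕_k.
  even-cycle-in-Fk : ∀ {m} → Cycle H m → Even (suc m) → ContainsFk H k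
  even-cycle-in-Fk {m} C even = inj₁ (m , even , ℕ.≤-trans (Fin.injective⇒≤ (inj C)) n≤2k , C)

  fk-free⇒no-even-cycle : FkFree H k → NoEvenCycle
  fk-free⇒no-even-cycle free {h ∷ t} cyc even = free (even-cycle-in-Fk (toCycle h t cyc) even)

  distinct-≤2k : ∀ {xs : List V} ℓ → length xs ≡ ℓ → Unique xs → ℓ ≤ 2 * k
  distinct-≤2k ℓ |xs|≡ℓ u = subst (_≤ 2 * k) |xs|≡ℓ (ℕ.≤-trans (unique-length u) n≤2k)

  touching-in-Fk : ∀ {h t₁ t₂} → IsCycle (h ∷ t₁) → IsCycle (h ∷ t₂) → Odd (length (h ∷ t₁)) →
                   Odd (length (h ∷ t₂)) → Disjoint t₁ t₂ → ContainsFk H k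
  touching-in-Fk {h} {t₁} {t₂} cyc₁ cyc₂ odd₁ odd₂ t₁#t₂ =
    inj₂ (length t₁ , length t₂ , 0 , odd₁ , odd₂ , bound , record
      { C₁ = toCycle h t₁ cyc₁ ; C₂ = toCycle h t₂ cyc₂ ; P = single-vertex
      ; start = refl ; end = refl ; disj₁₂ = meet-only-at-h
      ; disjP₁ = λ { Fin.zero _ _ → refl } ; disjP₂ = λ { Fin.zero _ _ → refl } })
    where
    single-vertex : Path H 0
    single-vertex = record { pvtx = λ _ → h ; pinj = λ { {Fin.zero} {Fin.zero} _ → refl } ; pstep = λ () }
    h∉t₁ : h ∉ t₁
    h∉t₁ = Unique[x∷xs]⇒x∉xs (distinct cyc₁)
    h∉t₂ : h ∉ t₂
    h∉t₂ = Unique[x∷xs]⇒x∉xs (distinct cyc₂)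
    meet-only-at-h : ∀ i j → lookup (h ∷ t₁) i ≡ lookup (h ∷ t₂) j → 0 ≡ 0 × i ≡ Fin.zero × j ≡ Fin.zero
    meet-only-at-h Fin.zero    Fin.zero    _ = refl , refl , refl
    meet-only-at-h Fin.zero    (Fin.suc j) e = ⊥-elim (h∉t₂ (subst (_∈ t₂) (sym e) (∈-lookup j)))
    meet-only-at-h (Fin.suc i) Fin.zero    e = ⊥-elim (h∉t₁ (subst (_∈ t₁) e (∈-lookup i)))
    meet-only-at-h (Fin.suc i) (Fin.suc j) e =
      ⊥-elim (t₁#t₂ (∈-lookup i , subst (_∈ t₂) (sym e) (∈-lookup j)))
    all-distinct : Unique (h ∷ t₁ ++ t₂)
    all-distinct = unique-∷ (λ h∈ → [ h∉t₁ , h∉t₂ ]′ (∈-++⁻ t₁ h∈))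
      (Unique.++⁺ (unique-++⁻ʳ (h ∷ []) (distinct cyc₁)) (unique-++⁻ʳ (h ∷ []) (distinct cyc₂)) t₁#t₂)
    bound : (suc (length t₁) + suc (length t₂) + 0) ∸ 1 ≤ 2 * k
    bound = distinct-≤2k _
      (trans (cong suc (length-++ t₁)) (sym (trans (ℕ.+-identityʳ _) (ℕ.+-suc (length t₁) (length t₂)))))
      all-distinct

  joined-in-Fk : ∀ {s t₁ z t₂ I} → IsCycle (s ∷ t₁) → IsCycle (z ∷ t₂) → Odd (length (s ∷ t₁)) →
                 Odd (length (z ∷ t₂)) → Disjoint (s ∷ t₁) (z ∷ t₂) →
                 Ear ((s ∷ t₁) ++ (z ∷ t₂)) s I z → ContainsFk H k
  joined-in-Fk {s} {t₁} {z} {t₂} {I} cyc₁ cyc₂ odd₁ odd₂ c₁#c₂ ear =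
    inj₂ (length t₁ , length t₂ , length (I ∷ʳ z) , odd₁ , odd₂ , bound , record
      { C₁ = toCycle s t₁ cyc₁ ; C₂ = toCycle z t₂ cyc₂
      ; P = toPath s (I ∷ʳ z) (ear-walk ear) (ear-path ear) ; start = refl ; end = lookup-last s I
      ; disj₁₂ = λ i j e → ⊥-elim (c₁#c₂ (∈-lookup i , subst (_∈ z ∷ t₂) (sym e) (∈-lookup j)))
      ; disjP₁ = λ i j e → leaves-C₁ i (subst (_∈ s ∷ t₁) (sym e) (∈-lookup j))
      ; disjP₂ = λ i j e → enters-C₂ i (subst (_∈ z ∷ t₂) (sym e) (∈-lookup j)) })
    where
    I#c₁ : Disjoint I (s ∷ t₁)
    I#c₁ (v∈I , v∈c₁) = ear-avoid ear (v∈I , ∈-++⁺ˡ v∈c₁)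
    I#c₂ : Disjoint I (z ∷ t₂)
    I#c₂ (v∈I , v∈c₂) = ear-avoid ear (v∈I , ∈-++⁺ʳ (s ∷ t₁) v∈c₂)
    leaves-C₁ : ∀ i → lookup (s ∷ I ∷ʳ z) i ∈ s ∷ t₁ → i ≡ Fin.zero
    leaves-C₁ i v∈c₁ with ∈-path I (∈-lookup i)
    ... | inj₁ v≡s         = unique-lookup-injective (ear-path ear) v≡s
    ... | inj₂ (inj₁ v∈I)  = ⊥-elim (I#c₁ (v∈I , v∈c₁))
    ... | inj₂ (inj₂ v≡z)  = ⊥-elim (c₁#c₂ (v∈c₁ , here v≡z))
    enters-C₂ : ∀ i → lookup (s ∷ I ∷ʳ z) i ∈ z ∷ t₂ → toℕ i ≡ length (I ∷ʳ z)
    enters-C₂ i v∈c₂ with ∈-path I (∈-lookup i)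
    ... | inj₁ v≡s         = ⊥-elim (c₁#c₂ (here v≡s , v∈c₂))
    ... | inj₂ (inj₁ v∈I)  = ⊥-elim (I#c₂ (v∈I , v∈c₂))
    ... | inj₂ (inj₂ v≡z)  =
      trans (cong toℕ (unique-lookup-injective (ear-path ear) (trans v≡z (sym (lookup-last s I)))))
            (Fin.toℕ-fromℕ _)
    all-distinct : Unique ((s ∷ t₁) ++ (z ∷ t₂) ++ I)
    all-distinct = Unique.++⁺ (distinct cyc₁)
      (Unique.++⁺ (distinct cyc₂) (unique-++⁻ˡ I (unique-++⁻ʳ (s ∷ []) (ear-path ear))) (Disjoint.sym I#c₂))
      (Disjoint.sym (disjoint-++ (Disjoint.sym c₁#c₂) I#c₁))
    arithmetic : ∀ a b i → suc a + (suc b + i) ≡ a + suc b + (i + 1)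
    arithmetic = solve-∀
    bound : (suc (length t₁) + suc (length t₂) + length (I ∷ʳ z)) ∸ 1 ≤ 2 * k
    bound = distinct-≤2k _
      (begin
        length ((s ∷ t₁) ++ (z ∷ t₂) ++ I)
          ≡⟨ length-++ (s ∷ t₁) ⟩
        suc (length t₁) + length ((z ∷ t₂) ++ I)
          ≡⟨ cong (suc (length t₁) +_) (length-++ (z ∷ t₂)) ⟩
        suc (length t₁) + (suc (length t₂) + length I)
          ≡⟨ arithmetic (length t₁) (length t₂) (length I) ⟩
        length t₁ + suc (length t₂) + (length I + 1)
          ≡⟨ cong (length t₁ + suc (length t₂) +_) (sym (length-++ I)) ⟩
        length t₁ + suc (length t₂) + length (I ∷ʳ z) ∎)
      all-distinct
      where open ≡-Reasoning

  fk-free⇒no-odd-dumbbell : FkFree H k → NoOddDumbbell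
  fk-free⇒no-odd-dumbbell free cyc₁ cyc₂ odd₁ odd₂ (touching t₁#t₂) =
    free (touching-in-Fk cyc₁ cyc₂ odd₁ odd₂ t₁#t₂)
  fk-free⇒no-odd-dumbbell free cyc₁ cyc₂ odd₁ odd₂ (joined c₁#c₂ I ear) =
    free (joined-in-Fk cyc₁ cyc₂ odd₁ odd₂ c₁#c₂ ear)

  walk-shares-edges : FkFree H k → ∀ {m m′} (C : Cycle H m) (C′ : Cycle H m′) → Odd (suc m) →
    Odd (suc m′) → ∀ {w} → IsWalk w → Any (_∈ cycle-list C) w → Any (_∈ cycle-list C′) w →
    ∀ {u v} → CycleEdge H C u v → CycleEdge H C′ u v
  walk-shares-edges free C C′ odd odd′ walk meets-C meets-C′ uv =
    edgeOf⇒cycleEdge C′ (edges-shared (fk-free⇒no-even-cycle free) (fk-free⇒no-odd-dumbbell free)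
      (cycle-list-isCycle C) (cycle-list-isCycle C′) (cycle-list-odd C odd) (cycle-list-odd C′ odd′)
      walk meets-C meets-C′ (cycleEdge⇒edgeOf C uv))

  -- So odd cycles in one component are the same subgraph: the walk between them serves both ways.
  joined-odd-cycles-same : FkFree H k → ∀ {m m′} (C : Cycle H m) (C′ : Cycle H m′) → Odd (suc m) →
                           Odd (suc m′) → Walk H (vtx C Fin.zero) (vtx C′ Fin.zero) → SameCycle H C C′
  joined-odd-cycles-same free C C′ odd odd′ wk u v =
    mk⇔ (walk-shares-edges free C  C′ odd  odd′ (walk-list-isWalk wk) meets-C  meets-C′)
        (walk-shares-edges free C′ C  odd′ odd  (walk-list-isWalk wk) meets-C′ meets-C)
    where
    meets-C : Any (_∈ cycle-list C) (walk-list wk)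
    meets-C = lose (walk-list-start wk) (here refl)
    meets-C′ : Any (_∈ cycle-list C′) (walk-list wk)
    meets-C′ = lose (walk-list-end wk) (here refl)

cycle-edge-end : ∀ {n} {H : Graph n} {m} (C : Cycle H m) {u v} → CycleEdge H C u v → ∃[ j ] (vtx C j ≡ v)
cycle-edge-end C (inj₁ (i , inj₁ (_ , e))) = Fin.suc i , e
cycle-edge-end C (inj₁ (i , inj₂ (e , _))) = inject₁ i , e
cycle-edge-end C (inj₂ (inj₁ (_ , e)))     = Fin.zero , e
cycle-edge-end C (inj₂ (inj₂ (e , _)))     = fromℕ _ , e

-- The two cycles of a member of 𝓕_k share at most one vertex, so they are different subgraphs:
-- the second vertex of the first cycle would have to lie on the second.
two-cycles-differ : ∀ {n} {H : Graph n} {m₁ m₂ p} (D : TwoCyclesPath H m₁ m₂ p) → ¬ SameCycle H (C₁ D) (C₂ D)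
two-cycles-differ {m₁ = zero} D _ with len≥3 (C₁ D)
... | ()
two-cycles-differ {m₁ = suc m} D same
  with cycle-edge-end (C₂ D) (Equivalence.to (same _ _) (inj₁ (Fin.zero , inj₁ (refl , refl))))
... | j , e with disj₁₂ D (Fin.suc Fin.zero) j (sym e)
... | _ , () , _

two-cycles-walk : ∀ {n} {H : Graph n} {m₁ m₂ p} (D : TwoCyclesPath H m₁ m₂ p) →
                  Walk H (vtx (C₁ D) Fin.zero) (vtx (C₂ D) Fin.zero)
two-cycles-walk {p = p} D = record
  { wlen = p ; wvtx = pvtx (P D) ; wstart = start D ; wend = end D ; wstep = pstep (P D) }

-- The theorem (the argument does not need k ≥ 2).
lemma4p4 : (k : ℕ) → 2 ≤ k → {n : ℕ} → (H : Graph n) → n ≤ 2 * k →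
    FkFree H k ⇔ (AllCyclesOdd H × AtMostOneOddCyclePerComponent H)
lemma4p4 k _ H n≤2k = mk⇔ forward backward
  where
  open InFk H k n≤2k
  forward : FkFree H k → AllCyclesOdd H × AtMostOneOddCyclePerComponent H
  forward free =
      (λ C even → free (even-cycle-in-Fk C even))
    , joined-odd-cycles-same free
  backward : AllCyclesOdd H × AtMostOneOddCyclePerComponent H → FkFree H k
  backward (all-odd , _)       (inj₁ (_ , even , _ , C))                  = all-odd C even
  backward (_ , one-odd-cycle) (inj₂ (_ , _ , _ , odd₁ , odd₂ , _ , D)) =
    two-cycles-differ D (one-odd-cycle (C₁ D) (C₂ D) odd₁ odd₂ (two-cycles-walk D))
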